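{- Let $G$ be a weighted graph and let $b$ be an unlooped vertex of degree one whose unique neighbor is the vertex $a\neq b$. Let $G'$ be the weighted graph obtained from $G-b$ by changing the weights of $a$ to \[ \alpha'(a)=\alpha(a)\beta(b),\qquad \beta'(a)=\alpha(a)\alpha(b)(x-1)^{2}+\beta(a)\alpha(b)(y-1)+\beta(a)\beta(b), \] all other vertices keeping their weights. Then $q(G)=q(G')$.
   Context: All graphs are finite and may have loops (at most one per vertex) but no multiple edges. The adjacency matrix of a graph is the symmetric $0/1$ matrix over $GF(2)$ whose diagonal entry at $v$ is $1$ iff $v$ is looped; $r(G)$ and $n(G)$ denote its rank and nullity over $GF(2)$ (the empty graph has $r=n=0$). For $S\subseteq V(G)$, $G[S]$ is the induced subgraph. Let $A$ be a commutative ring with unity containing elements $x,y$. A weighted graph is a graph $G$ together with functions $\alpha,\beta:V(G)\to A$, and its weighted interlace polynomial is \[ q(G)=\sum_{S\subseteq V(G)}\Big(\prod_{s\in S}\alpha(s)\Big)\Big(\prod_{v\notin S}\beta(v)\Big)(x-1)^{r(G[S])}(y-1)^{n(G[S])}. \] -}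

module Defs where

open import Level using (Level)
open import Algebra.Bundles using (CommutativeRing)
open import Data.Bool using (Bool; true; false; _∧_; _∨_; not; _xor_; if_then_else_)
open import Data.Nat using (ℕ; zero; suc; _∸_; _⊔_)
open import Data.Fin using (Fin; punchIn; _≟_)
open import Data.Fin.Subset using (Subset; ∣_∣)
open import Data.Vec using (Vec; []; _∷_; lookup)
open import Data.List using (List; []; _∷_; [_]; map; _++_; foldr; allFin)
open import Data.Bool.ListAction using (all; any)
open import Relation.Nullary using (does)
open import Relation.Binary.PropositionalEquality using (_≡_)

-- A finite graph on vertex set Fin n, possibly with loops, no multiple edges:
-- a symmetric 0/1 (Bool) adjacency matrix; adj v v = true iff v is looped.
record Graph (n : ℕ) : Set where
  field
    adj : Fin n → Fin n → Bool
    adj-sym : ∀ i j → adj i j ≡ adj j i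
open Graph public

subsets : (n : ℕ) → List (Subset n)
subsets zero = [ [] ]
subsets (suc n) = map (false ∷_) (subsets n) ++ map (true ∷_) (subsets n)

xorSum : List Bool → Bool
xorSum = foldr _xor_ false

_⊆ᵇ_ : ∀ {n} → Subset n → Subset n → Bool
_⊆ᵇ_ {n} U T = all (λ i → not (lookup U i) ∨ lookup T i) (allFin n)

nonemptyᵇ : ∀ {n} → Subset n → Bool
nonemptyᵇ {n} U = any (lookup U) (allFin n)

rowComb : ∀ {n} → Graph n → Subset n → Fin n → Bool
rowComb {n} G U j = xorSum (map (λ i → lookup U i ∧ adj G i j) (allFin n))

zeroOnᵇ : ∀ {n} → Subset n → (Fin n → Bool) → Bool
zeroOnᵇ {n} S v = all (λ j → not (lookup S j) ∨ not (v j)) (allFin n)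

-- The rows of the adjacency matrix of G[S] indexed by T ⊆ S are linearly
-- independent over GF(2): no nonempty U ⊆ T has rows (restricted to the
-- columns in S) summing to zero.
independentᵇ : ∀ {n} → Graph n → Subset n → Subset n → Bool
independentᵇ {n} G S T =
  all (λ U → not (U ⊆ᵇ T ∧ nonemptyᵇ U) ∨ not (zeroOnᵇ S (rowComb G U))) (subsets n)

-- r(G[S]): the GF(2)-rank of the adjacency matrix of G[S], i.e. the maximal
-- number of linearly independent rows.
rank : ∀ {n} → Graph n → Subset n → ℕ
rank {n} G S =
  foldr _⊔_ 0 (map (λ T → if (T ⊆ᵇ S ∧ independentᵇ G S T) then ∣ T ∣ else 0) (subsets n))

nullity : ∀ {n} → Graph n → Subset n → ℕ
nullity G S = ∣ S ∣ ∸ rank G S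

deleteVertex : ∀ {m} → Graph (suc m) → Fin (suc m) → Graph m
deleteVertex G b = record
  { adj = λ i j → adj G (punchIn b i) (punchIn b j)
  ; adj-sym = λ i j → adj-sym G (punchIn b i) (punchIn b j) }

module WeightedInterlace {c ℓ : Level} (R : CommutativeRing c ℓ) where
  open CommutativeRing R

  infixr 8 _^ᴿ_
  _^ᴿ_ : Carrier → ℕ → Carrier
  z ^ᴿ zero = 1#
  z ^ᴿ suc k = z * (z ^ᴿ k)

  sumᴿ : List Carrier → Carrier
  sumᴿ = foldr _+_ 0#

  prodᴿ : List Carrier → Carrier
  prodᴿ = foldr _*_ 1#

  q : ∀ {n} → (x y : Carrier) → (α β : Fin n → Carrier) → Graph n → Carrier
  q {n} x y α β G =
    sumᴿ (map (λ S →
        prodᴿ (map (λ v → if lookup S v then α v else β v) (allFin n))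
        * ((x - 1#) ^ᴿ rank G S)
        * ((y - 1#) ^ᴿ nullity G S))
      (subsets n))

  α-new : ∀ {m} → (α β : Fin (suc m) → Carrier) → (a b : Fin (suc m)) → Fin m → Carrier
  α-new α β a b v with does (punchIn b v ≟ a)
  ... | true  = α a * β b
  ... | false = α (punchIn b v)

  β-new : ∀ {m} → (x y : Carrier) → (α β : Fin (suc m) → Carrier) → (a b : Fin (suc m)) → Fin m → Carrier
  β-new x y α β a b v with does (punchIn b v ≟ a)
  ... | true  = α a * α b * ((x - 1#) ^ᴿ 2) + β a * α b * (y - 1#) + β a * β b
  ... | false = β (punchIn b v)

-- Split the sum defining q(G) according to how S meets {a, b}. If b ∉ S, then G[S] = (G − b)[S].
-- If b ∈ S and a ∉ S, then b is an isolated unlooped vertex of G[S]: the rank is that of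
-- G[S − b] and the nullity is one larger. If a, b ∈ S, then row and column b of the adjacency
-- matrix of G[S] are the unit vectors at a; eliminating them gives r(G[S]) = 2 + r(G[S − a − b])
-- with the nullity unchanged. For each subset s of V(G) − {a, b}, the four summands with
-- S − {a, b} = s therefore add up to the summands of q(G − b) at s and s + a, once a carries the
-- weights α′(a), β′(a). As r is the largest size of a GF(2)-independent set of rows, the three
-- rank identities are proved by transforming independent row sets.

module Submission where

open import Defs
open import Algebra.Bundles using (CommutativeRing; CommutativeMonoid)
import Algebra.Properties.CommutativeMonoid.Sum as MonoidSum
open import Data.Bool using (Bool; true; false; _∧_; _∨_; not; _xor_; if_then_else_)
open import Data.Bool.Properties
  using (xor-∧-commutativeRing; xor-identityʳ; ∧-zeroʳ; ∧-identityʳ; ∧-distribʳ-xor; ¬-not)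
open import Data.Bool.ListAction using (all; any)
open import Data.Nat using (ℕ; zero; suc; _+_; _∸_; _⊔_; _≤_; z≤n; s≤s)
import Data.Nat.Properties as ℕ
open import Data.Fin using (Fin; zero; suc; punchIn; punchOut; _≟_)
open import Data.Fin.Properties using (punchInᵢ≢i; punchIn-punchOut; punchIn-injective)
open import Data.Fin.Subset using (Subset; ∣_∣) renaming (⊥ to ∅)
open import Data.Fin.Subset.Properties using (p⊆q⇒∣p∣≤∣q∣; ∣⊥∣≡0)
open import Data.Vec using (Vec; []; _∷_; lookup; insertAt; removeAt; _[_]≔_; zipWith)
open import Data.Vec.Properties
  using (lookup∘update; lookup∘update′; []≔-idempotent; []≔-lookup; lookup-replicate;
         lookup-zipWith; insertAt-lookup; insertAt-punchIn; insertAt-removeAt; lookup⇒[]=; []=⇒lookup)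
open import Data.List using (List; []; _∷_; map; _++_; foldr; allFin; tabulate)
import Data.List.Properties as List
open import Data.List.Membership.Propositional using (_∈_)
open import Data.List.Membership.Propositional.Properties using (∈-allFin; ∈-map⁺; ∈-++⁺ˡ; ∈-++⁺ʳ)
open import Data.List.Relation.Unary.Any using (here; there)
open import Data.Product using (∃; _×_; _,_)
open import Data.Sum using (_⊎_; inj₁; inj₂)
open import Function using (_∘_)
open import Relation.Nullary using (yes; no; contradiction)
open import Relation.Binary.PropositionalEquality
  using (_≡_; _≢_; refl; sym; trans; cong; cong₂; subst; module ≡-Reasoning)

-- Sums over all subsets

module SubsetSum {c ℓ} (M : CommutativeMonoid c ℓ) where
  open CommutativeMonoid M renaming (refl to ≈-refl; sym to ≈-sym; trans to ≈-trans)
  open MonoidSum M using (sum)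
  open import Algebra.Properties.CommutativeSemigroup commutativeSemigroup using (interchange)
  open import Relation.Binary.Reasoning.Setoid setoid

  sumList : List Carrier → Carrier
  sumList = foldr _∙_ ε

  sum-allFin : ∀ {n} (f : Fin n → Carrier) → sumList (map f (allFin n)) ≡ sum f
  sum-allFin f = trans (cong sumList (List.map-tabulate (λ i → i) f)) (sum-tabulate f)
    where
    sum-tabulate : ∀ {n} (f : Fin n → Carrier) → sumList (tabulate f) ≡ sum f
    sum-tabulate {zero} f = refl
    sum-tabulate {suc n} f = cong (f zero ∙_) (sum-tabulate (f ∘ suc))

  sumList-++ : ∀ xs ys → sumList (xs ++ ys) ≈ sumList xs ∙ sumList ys
  sumList-++ [] ys = ≈-sym (identityˡ _)
  sumList-++ (x ∷ xs) ys = ≈-trans (∙-congˡ (sumList-++ xs ys)) (≈-sym (assoc _ _ _))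

  module _ {a} {A : Set a} where
    sumList-map-cong : ∀ {f g : A → Carrier} xs → (∀ x → f x ≈ g x) →
                       sumList (map f xs) ≈ sumList (map g xs)
    sumList-map-cong [] f≈g = ≈-refl
    sumList-map-cong (x ∷ xs) f≈g = ∙-cong (f≈g x) (sumList-map-cong xs f≈g)

    sumList-map-∙ : ∀ (f g : A → Carrier) xs →
                    sumList (map (λ x → f x ∙ g x) xs) ≈ sumList (map f xs) ∙ sumList (map g xs)
    sumList-map-∙ f g [] = ≈-sym (identityˡ ε)
    sumList-map-∙ f g (x ∷ xs) = begin
      (f x ∙ g x) ∙ sumList (map (λ x → f x ∙ g x) xs)
        ≈⟨ ∙-congˡ (sumList-map-∙ f g xs) ⟩
      (f x ∙ g x) ∙ (sumList (map f xs) ∙ sumList (map g xs))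
        ≈⟨ interchange (f x) (g x) _ _ ⟩
      (f x ∙ sumList (map f xs)) ∙ (g x ∙ sumList (map g xs)) ∎

  sumSubsets : ∀ k → (Subset k → Carrier) → Carrier
  sumSubsets k F = sumList (map F (subsets k))

  sumSubsets-suc : ∀ k (F : Subset (suc k) → Carrier) →
    sumSubsets (suc k) F ≈ sumSubsets k (λ S → F (false ∷ S)) ∙ sumSubsets k (λ S → F (true ∷ S))
  sumSubsets-suc k F = begin
    sumList (map F (map (false ∷_) (subsets k) ++ map (true ∷_) (subsets k)))
      ≡⟨ cong sumList (List.map-++ F (map (false ∷_) (subsets k)) _) ⟩
    sumList (map F (map (false ∷_) (subsets k)) ++ map F (map (true ∷_) (subsets k)))
      ≈⟨ sumList-++ (map F (map (false ∷_) (subsets k))) _ ⟩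
    sumList (map F (map (false ∷_) (subsets k))) ∙ sumList (map F (map (true ∷_) (subsets k)))
      ≡⟨ cong₂ (λ u v → sumList u ∙ sumList v)
               (sym (List.map-∘ (subsets k))) (sym (List.map-∘ (subsets k))) ⟩
    sumSubsets k (λ S → F (false ∷ S)) ∙ sumSubsets k (λ S → F (true ∷ S)) ∎

  sumSubsets-insertAt : ∀ k (p : Fin (suc k)) (F : Subset (suc k) → Carrier) →
    sumSubsets (suc k) F ≈ sumSubsets k (λ S → F (insertAt S p false) ∙ F (insertAt S p true))
  sumSubsets-insertAt k zero F = ≈-trans (sumSubsets-suc k F) (≈-sym (sumList-map-∙ _ _ (subsets k)))
  sumSubsets-insertAt (suc k) (suc p) F = begin
    sumSubsets (suc (suc k)) F
      ≈⟨ sumSubsets-suc (suc k) F ⟩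
    sumSubsets (suc k) (λ S → F (false ∷ S)) ∙ sumSubsets (suc k) (λ S → F (true ∷ S))
      ≈⟨ ∙-cong (sumSubsets-insertAt k p (λ S → F (false ∷ S)))
                (sumSubsets-insertAt k p (λ S → F (true ∷ S))) ⟩
    sumSubsets k (λ S → F (false ∷ insertAt S p false) ∙ F (false ∷ insertAt S p true))
      ∙ sumSubsets k (λ S → F (true ∷ insertAt S p false) ∙ F (true ∷ insertAt S p true))
      ≈⟨ ≈-sym (sumSubsets-suc k _) ⟩
    sumSubsets (suc k) (λ S → F (insertAt S (suc p) false) ∙ F (insertAt S (suc p) true)) ∎

-- Subsets as predicates

true≢false : ∀ {a} {A : Set a} {b : Bool} → b ≡ true → b ≡ false → A
true≢false b≡true b≡false = contradiction (trans (sym b≡true) b≡false) λ ()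

module _ {a} {A : Set a} (p : A → Bool) where
  all-sound : ∀ xs → all p xs ≡ true → ∀ {x} → x ∈ xs → p x ≡ true
  all-sound (y ∷ xs) h (here refl) with p y
  ... | true = refl
  all-sound (y ∷ xs) h (there x∈xs) with p y
  ... | true = all-sound xs h x∈xs

  all-complete : ∀ xs → (∀ x → p x ≡ true) → all p xs ≡ true
  all-complete [] h = refl
  all-complete (y ∷ xs) h rewrite h y = all-complete xs h

  all-false : ∀ xs → all p xs ≡ false → ∃ λ x → p x ≡ false
  all-false (y ∷ xs) h with p y in e
  ... | true = all-false xs h
  ... | false = y , e

  any-sound : ∀ xs → any p xs ≡ true → ∃ λ x → p x ≡ true
  any-sound (y ∷ xs) h with p y in e
  ... | true = y , e
  ... | false = any-sound xs h

  any-complete : ∀ xs {x} → x ∈ xs → p x ≡ true → any p xs ≡ true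
  any-complete (y ∷ xs) (here refl) h rewrite h = refl
  any-complete (y ∷ xs) (there x∈xs) h with p y
  ... | true = refl
  ... | false = any-complete xs x∈xs h

∈-subsets : ∀ n (U : Subset n) → U ∈ subsets n
∈-subsets zero [] = here refl
∈-subsets (suc n) (false ∷ U) = ∈-++⁺ˡ (∈-map⁺ (false ∷_) (∈-subsets n U))
∈-subsets (suc n) (true ∷ U) = ∈-++⁺ʳ (map (false ∷_) (subsets n)) (∈-map⁺ (true ∷_) (∈-subsets n U))

_∋_ : ∀ {n} → Subset n → Fin n → Set
U ∋ i = lookup U i ≡ true

_⊆_ : ∀ {n} → Subset n → Subset n → Set
U ⊆ T = ∀ i → U ∋ i → T ∋ i

Nonempty : ∀ {n} → Subset n → Set
Nonempty U = ∃ (U ∋_)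

⊆ᵇ-sound : ∀ {n} {U T : Subset n} → U ⊆ᵇ T ≡ true → U ⊆ T
⊆ᵇ-sound {n} {U} {T} h i U∋i with all-sound (λ i → not (lookup U i) ∨ lookup T i) (allFin n) h (∈-allFin i)
... | r rewrite U∋i = r

⊆ᵇ-complete : ∀ {n} {U T : Subset n} → U ⊆ T → U ⊆ᵇ T ≡ true
⊆ᵇ-complete {n} {U} {T} U⊆T = all-complete _ (allFin n) pointwise
  where
  pointwise : ∀ i → not (lookup U i) ∨ lookup T i ≡ true
  pointwise i with lookup U i in e
  ... | false = refl
  ... | true = U⊆T i e

nonemptyᵇ-sound : ∀ {n} {U : Subset n} → nonemptyᵇ U ≡ true → Nonempty U
nonemptyᵇ-sound {n} {U} = any-sound (lookup U) (allFin n)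

nonemptyᵇ-complete : ∀ {n} {U : Subset n} → Nonempty U → nonemptyᵇ U ≡ true
nonemptyᵇ-complete {n} {U} (i , U∋i) = any-complete (lookup U) (allFin n) (∈-allFin i) U∋i

nonempty-or-empty : ∀ {n} (U : Subset n) → Nonempty U ⊎ (∀ i → lookup U i ≡ false)
nonempty-or-empty U with nonemptyᵇ U in e
... | true = inj₁ (nonemptyᵇ-sound {U = U} e)
... | false = inj₂ λ i → ¬-not λ U∋i → true≢false (nonemptyᵇ-complete {U = U} (i , U∋i)) e

zeroOnᵇ-sound : ∀ {n} {S : Subset n} {v : Fin n → Bool} →
                zeroOnᵇ S v ≡ true → ∀ j → S ∋ j → v j ≡ false
zeroOnᵇ-sound {n} {S} {v} h j S∋j
  with all-sound (λ j → not (lookup S j) ∨ not (v j)) (allFin n) h (∈-allFin j)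
... | r rewrite S∋j with v j
... | false = refl

zeroOnᵇ-false : ∀ {n} {S : Subset n} {v : Fin n → Bool} →
                zeroOnᵇ S v ≡ false → ∃ λ j → S ∋ j × v j ≡ true
zeroOnᵇ-false {n} {S} {v} h with all-false (λ j → not (lookup S j) ∨ not (v j)) (allFin n) h
... | j , e with lookup S j in S∋j | v j in vj
... | true | true = j , S∋j , vj

⊆-∉ : ∀ {n} (T′ T : Subset n) {i} → T′ ⊆ T → lookup T i ≡ false → lookup T′ i ≡ false
⊆-∉ T′ T T′⊆T i∉T = ¬-not λ T′∋i → true≢false (T′⊆T _ T′∋i) i∉T

[]≔false-⊆ : ∀ {n} (U : Subset n) i → (U [ i ]≔ false) ⊆ U
[]≔false-⊆ U i j h with j ≟ i
... | yes refl = true≢false h (lookup∘update i U false)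
... | no j≢i = trans (sym (lookup∘update′ j≢i U false)) h

∋-[]≔false : ∀ {n} {U : Subset n} {i j} → U ∋ j → j ≢ i → (U [ i ]≔ false) ∋ j
∋-[]≔false {U = U} U∋j j≢i = trans (lookup∘update′ j≢i U false) U∋j

⊆-[]≔false : ∀ {n} {T S : Subset n} i → lookup T i ≡ false → T ⊆ S → T ⊆ (S [ i ]≔ false)
⊆-[]≔false {S = S} i i∉T T⊆S j T∋j with j ≟ i
... | yes refl = true≢false T∋j i∉T
... | no j≢i = ∋-[]≔false {U = S} (T⊆S j T∋j) j≢i

[]≔false-mono : ∀ {n} {T S : Subset n} i → T ⊆ S → (T [ i ]≔ false) ⊆ (S [ i ]≔ false)
[]≔false-mono {T = T} {S} i T⊆S =
  ⊆-[]≔false {T = T [ i ]≔ false} {S} i (lookup∘update i T false) (λ j h → T⊆S j ([]≔false-⊆ T i j h))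

[]≔true-⊆ : ∀ {n} {U T : Subset n} i → U ⊆ T → T ∋ i → (U [ i ]≔ true) ⊆ T
[]≔true-⊆ {U = U} i U⊆T T∋i j h with j ≟ i
... | yes refl = T∋i
... | no j≢i = U⊆T j (trans (sym (lookup∘update′ j≢i U true)) h)

∣[]≔true∣ : ∀ {n} (S : Subset n) p → lookup S p ≡ false → ∣ S [ p ]≔ true ∣ ≡ suc ∣ S ∣
∣[]≔true∣ (false ∷ S) zero refl = refl
∣[]≔true∣ (true ∷ S) (suc p) p∉S = cong suc (∣[]≔true∣ S p p∉S)
∣[]≔true∣ (false ∷ S) (suc p) p∉S = ∣[]≔true∣ S p p∉S

∣[]≔false∣ : ∀ {n} (S : Subset n) p → S ∋ p → ∣ S ∣ ≡ suc ∣ S [ p ]≔ false ∣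
∣[]≔false∣ (true ∷ S) zero refl = refl
∣[]≔false∣ (true ∷ S) (suc p) S∋p = cong suc (∣[]≔false∣ S p S∋p)
∣[]≔false∣ (false ∷ S) (suc p) S∋p = ∣[]≔false∣ S p S∋p

∣∣≤suc∣[]≔false∣ : ∀ {n} (S : Subset n) p → ∣ S ∣ ≤ suc ∣ S [ p ]≔ false ∣
∣∣≤suc∣[]≔false∣ S p with lookup S p in e
... | true = ℕ.≤-reflexive (∣[]≔false∣ S p e)
... | false = ℕ.m≤n⇒m≤1+n (ℕ.≤-reflexive (cong ∣_∣ unchanged))
  where
  unchanged : S ≡ S [ p ]≔ false
  unchanged = sym (trans (cong (S [ p ]≔_) (sym e)) ([]≔-lookup S p))

∣insertAt∣ : ∀ {n} (S : Subset n) p v → ∣ insertAt S p v ∣ ≡ (if v then suc ∣ S ∣ else ∣ S ∣)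
∣insertAt∣ S zero true = refl
∣insertAt∣ S zero false = refl
∣insertAt∣ (true ∷ S) (suc p) true = cong suc (∣insertAt∣ S p true)
∣insertAt∣ (true ∷ S) (suc p) false = cong suc (∣insertAt∣ S p false)
∣insertAt∣ (false ∷ S) (suc p) v = ∣insertAt∣ S p v

⊆⇒∣∣≤ : ∀ {n} {T S : Subset n} → T ⊆ S → ∣ T ∣ ≤ ∣ S ∣
⊆⇒∣∣≤ {T = T} {S} T⊆S =
  p⊆q⇒∣p∣≤∣q∣ {p = T} {q = S} λ {i} i∈T → lookup⇒[]= i S (T⊆S i ([]=⇒lookup i∈T))

insertAt-[]≔ : ∀ {n} {A : Set} (t : Vec A n) p v w → insertAt t p v [ p ]≔ w ≡ insertAt t p w
insertAt-[]≔ t zero v w = refl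
insertAt-[]≔ (x ∷ t) (suc p) v w = cong (x ∷_) (insertAt-[]≔ t p v w)

insertAt-[]≔-punchIn : ∀ {n} {A : Set} (t : Vec A n) p v i w →
  insertAt t p v [ punchIn p i ]≔ w ≡ insertAt (t [ i ]≔ w) p v
insertAt-[]≔-punchIn t zero v i w = refl
insertAt-[]≔-punchIn (x ∷ t) (suc p) v zero w = refl
insertAt-[]≔-punchIn (x ∷ t) (suc p) v (suc i) w = cong (x ∷_) (insertAt-[]≔-punchIn t p v i w)

∅⊆ : ∀ {n} (U : Subset n) → ∅ ⊆ U
∅⊆ U i h = true≢false h (lookup-replicate i false)

-- Row combinations over GF(2)

open CommutativeRing xor-∧-commutativeRing using () renaming (+-commutativeMonoid to xor-commutativeMonoid)
module ⊕ = MonoidSum xor-commutativeMonoid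

rowComb-sum : ∀ {n} (G : Graph n) U j → rowComb G U j ≡ ⊕.sum (λ i → lookup U i ∧ adj G i j)
rowComb-sum G U j = SubsetSum.sum-allFin xor-commutativeMonoid (λ i → lookup U i ∧ adj G i j)

rowComb-zero : ∀ {n} (G : Graph n) U j → (∀ i → U ∋ i → adj G i j ≡ false) → rowComb G U j ≡ false
rowComb-zero {n} G U j h = trans (rowComb-sum G U j) (trans (⊕.sum-cong-≗ vanishes) (⊕.sum-replicate-zero n))
  where
  vanishes : ∀ i → lookup U i ∧ adj G i j ≡ false
  vanishes i with lookup U i in e
  ... | false = refl
  ... | true = h i e

rowComb-split : ∀ {n} (G : Graph (suc n)) U b j →
  rowComb G U j ≡ (lookup U b ∧ adj G b j) xor rowComb G (U [ b ]≔ false) j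
rowComb-split {n} G U b j = begin
  rowComb G U j                             ≡⟨ rowComb-sum G U j ⟩
  ⊕.sum (term U)                            ≡⟨ ⊕.sum-remove {i = b} (term U) ⟩
  term U b xor ⊕.sum (term U ∘ punchIn b)   ≡⟨ cong (term U b xor_) (⊕.sum-cong-≗ unchanged) ⟩
  term U b xor ⊕.sum (term U′ ∘ punchIn b)  ≡⟨ cong (term U b xor_) (sym U′-sum) ⟩
  term U b xor rowComb G U′ j               ∎
  where
  open ≡-Reasoning
  U′ : Subset (suc n)
  U′ = U [ b ]≔ false
  term : Subset (suc n) → Fin (suc n) → Bool
  term V i = lookup V i ∧ adj G i j
  unchanged : ∀ i → term U (punchIn b i) ≡ term U′ (punchIn b i)
  unchanged i = cong (_∧ adj G (punchIn b i) j) (sym (lookup∘update′ (punchInᵢ≢i b i) U false))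
  U′-sum : rowComb G U′ j ≡ ⊕.sum (term U′ ∘ punchIn b)
  U′-sum = trans (rowComb-sum G U′ j) (trans (⊕.sum-remove {i = b} (term U′))
                   (cong (λ c → c ∧ adj G b j xor ⊕.sum (term U′ ∘ punchIn b)) (lookup∘update b U false)))

rowComb-add : ∀ {n} (G : Graph (suc n)) U b j → lookup U b ≡ false →
  rowComb G (U [ b ]≔ true) j ≡ adj G b j xor rowComb G U j
rowComb-add G U b j b∉U = begin
  rowComb G (U [ b ]≔ true) j
    ≡⟨ rowComb-split G (U [ b ]≔ true) b j ⟩
  (lookup (U [ b ]≔ true) b ∧ adj G b j) xor rowComb G ((U [ b ]≔ true) [ b ]≔ false) j
    ≡⟨ cong₂ (λ c V → (c ∧ adj G b j) xor rowComb G V j) (lookup∘update b U true) ([]≔-idempotent U b) ⟩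
  adj G b j xor rowComb G (U [ b ]≔ false) j
    ≡⟨ cong (λ c → adj G b j xor rowComb G (U [ b ]≔ c) j) (sym b∉U) ⟩
  adj G b j xor rowComb G (U [ b ]≔ lookup U b) j
    ≡⟨ cong (λ V → adj G b j xor rowComb G V j) ([]≔-lookup U b) ⟩
  adj G b j xor rowComb G U j ∎
  where open ≡-Reasoning

rowComb-column : ∀ {n} (G : Graph (suc n)) U a j → (∀ i → i ≢ a → adj G i j ≡ false) →
  rowComb G U j ≡ lookup U a ∧ adj G a j
rowComb-column G U a j only-a = trans (rowComb-split G U a j)
  (trans (cong (lookup U a ∧ adj G a j xor_) (rowComb-zero G (U [ a ]≔ false) j outside-a))
         (xor-identityʳ _))
  where
  outside-a : ∀ i → (U [ a ]≔ false) ∋ i → adj G i j ≡ false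
  outside-a i h = only-a i λ { refl → true≢false h (lookup∘update a U false) }

rowComb-xor : ∀ {n} (G : Graph n) U V j →
  rowComb G (zipWith _xor_ U V) j ≡ rowComb G U j xor rowComb G V j
rowComb-xor G U V j = begin
  rowComb G (zipWith _xor_ U V) j
    ≡⟨ rowComb-sum G (zipWith _xor_ U V) j ⟩
  ⊕.sum (λ i → lookup (zipWith _xor_ U V) i ∧ adj G i j)
    ≡⟨ ⊕.sum-cong-≗ distrib ⟩
  ⊕.sum (λ i → (lookup U i ∧ adj G i j) xor (lookup V i ∧ adj G i j))
    ≡⟨ ⊕.∑-distrib-+ (λ i → lookup U i ∧ adj G i j) (λ i → lookup V i ∧ adj G i j) ⟩
  ⊕.sum (λ i → lookup U i ∧ adj G i j) xor ⊕.sum (λ i → lookup V i ∧ adj G i j)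
    ≡⟨ sym (cong₂ _xor_ (rowComb-sum G U j) (rowComb-sum G V j)) ⟩
  rowComb G U j xor rowComb G V j ∎
  where
  open ≡-Reasoning
  distrib : ∀ i → lookup (zipWith _xor_ U V) i ∧ adj G i j
                  ≡ (lookup U i ∧ adj G i j) xor (lookup V i ∧ adj G i j)
  distrib i = trans (cong (_∧ adj G i j) (lookup-zipWith _xor_ i U V))
                    (∧-distribʳ-xor (adj G i j) (lookup U i) (lookup V i))

rowComb-deleteVertex : ∀ {n} (G : Graph (suc n)) U b j →
  rowComb G (insertAt U b false) (punchIn b j) ≡ rowComb (deleteVertex G b) U j
rowComb-deleteVertex {n} G U b j = begin
  rowComb G (insertAt U b false) (punchIn b j)
    ≡⟨ rowComb-sum G (insertAt U b false) (punchIn b j) ⟩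
  ⊕.sum term
    ≡⟨ ⊕.sum-remove {i = b} term ⟩
  term b xor ⊕.sum (term ∘ punchIn b)
    ≡⟨ cong₂ _xor_ (cong (_∧ adj G b (punchIn b j)) (insertAt-lookup U b false))
                   (⊕.sum-cong-≗ λ i → cong (_∧ adj G (punchIn b i) (punchIn b j))
                                              (insertAt-punchIn U b false i)) ⟩
  ⊕.sum (λ i → lookup U i ∧ adj (deleteVertex G b) i j)
    ≡⟨ sym (rowComb-sum (deleteVertex G b) U j) ⟩
  rowComb (deleteVertex G b) U j ∎
  where
  open ≡-Reasoning
  term : Fin (suc n) → Bool
  term i = lookup (insertAt U b false) i ∧ adj G i (punchIn b j)

-- Independent row sets and rank

Independent : ∀ {n} → Graph n → Subset n → Subset n → Set
Independent G C T = ∀ U → U ⊆ T → Nonempty U → ∃ λ j → C ∋ j × rowComb G U j ≡ true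

independentᵇ-complete : ∀ {n} (G : Graph n) C T → Independent G C T → independentᵇ G C T ≡ true
independentᵇ-complete {n} G C T ind = all-complete _ (subsets n) pointwise
  where
  pointwise : ∀ U → not (U ⊆ᵇ T ∧ nonemptyᵇ U) ∨ not (zeroOnᵇ C (rowComb G U)) ≡ true
  pointwise U with U ⊆ᵇ T in U⊆T | nonemptyᵇ U in U≠∅ | zeroOnᵇ C (rowComb G U) in zero
  ... | false | _ | _ = refl
  ... | true | false | _ = refl
  ... | true | true | false = refl
  ... | true | true | true with ind U (⊆ᵇ-sound {U = U} {T = T} U⊆T) (nonemptyᵇ-sound {U = U} U≠∅)
  ... | j , C∋j , nonzero = true≢false nonzero (zeroOnᵇ-sound {S = C} zero j C∋j)

independentᵇ-sound : ∀ {n} (G : Graph n) C T → independentᵇ G C T ≡ true → Independent G C T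
independentᵇ-sound {n} G C T h U U⊆T U≠∅ =
  witness (all-sound (λ U → not (U ⊆ᵇ T ∧ nonemptyᵇ U) ∨ not (zeroOnᵇ C (rowComb G U)))
                     (subsets n) h (∈-subsets n U))
  where
  witness : not (U ⊆ᵇ T ∧ nonemptyᵇ U) ∨ not (zeroOnᵇ C (rowComb G U)) ≡ true →
            ∃ λ j → C ∋ j × rowComb G U j ≡ true
  witness r rewrite ⊆ᵇ-complete {U = U} {T = T} U⊆T | nonemptyᵇ-complete {U = U} U≠∅
    with zeroOnᵇ C (rowComb G U) in e
  witness () | true
  witness r | false = zeroOnᵇ-false {S = C} e

independent-or-dependent : ∀ {n} (G : Graph n) C T →
  Independent G C T ⊎ ∃ λ U → U ⊆ T × Nonempty U × (∀ j → C ∋ j → rowComb G U j ≡ false)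
independent-or-dependent {n} G C T with independentᵇ G C T in e
... | true = inj₁ (independentᵇ-sound G C T e)
... | false with all-false (λ U → not (U ⊆ᵇ T ∧ nonemptyᵇ U) ∨ not (zeroOnᵇ C (rowComb G U))) (subsets n) e
... | U , r with U ⊆ᵇ T in U⊆T | nonemptyᵇ U in U≠∅ | zeroOnᵇ C (rowComb G U) in zero
... | true | true | true =
  inj₂ (U , ⊆ᵇ-sound {U = U} {T = T} U⊆T , nonemptyᵇ-sound {U = U} U≠∅ , zeroOnᵇ-sound {S = C} zero)

module _ {a} {A : Set a} (f : A → ℕ) where
  ≤-maximum : ∀ xs {x} → x ∈ xs → f x ≤ foldr _⊔_ 0 (map f xs)
  ≤-maximum (y ∷ xs) (here refl) = ℕ.m≤m⊔n (f y) _
  ≤-maximum (y ∷ xs) (there x∈xs) = ℕ.≤-trans (≤-maximum xs x∈xs) (ℕ.m≤n⊔m (f y) _)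

  maximum-≤ : ∀ xs {k} → (∀ x → f x ≤ k) → foldr _⊔_ 0 (map f xs) ≤ k
  maximum-≤ [] h = z≤n
  maximum-≤ (y ∷ xs) h = ℕ.⊔-lub (h y) (maximum-≤ xs h)

rank-≥ : ∀ {n} (G : Graph n) S T → T ⊆ S → Independent G S T → ∣ T ∣ ≤ rank G S
rank-≥ {n} G S T T⊆S ind = subst (_≤ rank G S) counted
  (≤-maximum (λ T → if (T ⊆ᵇ S ∧ independentᵇ G S T) then ∣ T ∣ else 0) (subsets n) (∈-subsets n T))
  where
  counted : (if (T ⊆ᵇ S ∧ independentᵇ G S T) then ∣ T ∣ else 0) ≡ ∣ T ∣
  counted = cong (λ c → if c then ∣ T ∣ else 0)
                 (cong₂ _∧_ (⊆ᵇ-complete {U = T} {T = S} T⊆S) (independentᵇ-complete G S T ind))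

rank-≤ : ∀ {n} (G : Graph n) S {k} → (∀ T → T ⊆ S → Independent G S T → ∣ T ∣ ≤ k) → rank G S ≤ k
rank-≤ {n} G S {k} h = maximum-≤ _ (subsets n) bounded
  where
  bounded : ∀ T → (if (T ⊆ᵇ S ∧ independentᵇ G S T) then ∣ T ∣ else 0) ≤ k
  bounded T with T ⊆ᵇ S in T⊆S | independentᵇ G S T in ind
  ... | false | _ = z≤n
  ... | true | false = z≤n
  ... | true | true = h T (⊆ᵇ-sound {U = T} {T = S} T⊆S) (independentᵇ-sound G S T ind)

rank≤∣∣ : ∀ {n} (G : Graph n) S → rank G S ≤ ∣ S ∣
rank≤∣∣ G S = rank-≤ G S λ T T⊆S _ → ⊆⇒∣∣≤ {T = T} {S} T⊆S

∅-independent : ∀ {n} (G : Graph n) C → Independent G C ∅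
∅-independent G C U U⊆∅ (i , U∋i) = true≢false (U⊆∅ i U∋i) (lookup-replicate i false)

rank-liftIndependent : ∀ {n} (G : Graph n) S S′ k →
  (∀ T → T ⊆ S′ → Independent G S′ T → k + ∣ T ∣ ≤ rank G S) → k + rank G S′ ≤ rank G S
rank-liftIndependent {n} G S S′ k lift = subst (k + rank G S′ ≤_) (ℕ.m+[n∸m]≡n k≤rank)
  (ℕ.+-monoʳ-≤ k (rank-≤ G S′ λ T T⊆S′ ind →
    ℕ.≤-trans (ℕ.≤-reflexive (sym (ℕ.m+n∸m≡n k ∣ T ∣))) (ℕ.∸-monoˡ-≤ k (lift T T⊆S′ ind))))
  where
  k≤rank : k ≤ rank G S
  k≤rank = ℕ.≤-trans (ℕ.≤-reflexive (sym (trans (cong (k +_) (∣⊥∣≡0 n)) (ℕ.+-identityʳ k))))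
                     (lift ∅ (∅⊆ S′) (∅-independent G S′))

xor-⊆ : ∀ {n} {U V T : Subset n} → U ⊆ T → V ⊆ T → zipWith _xor_ U V ⊆ T
xor-⊆ {U = U} {V} U⊆T V⊆T i h with lookup U i in U∋i | trans (sym (lookup-zipWith _xor_ i U V)) h
... | true | _ = U⊆T i U∋i
... | false | V∋i = V⊆T i V∋i

independent-widen : ∀ {n} (G : Graph n) C C′ T → C ⊆ C′ → Independent G C T → Independent G C′ T
independent-widen G C C′ T C⊆C′ ind U U⊆T U≠∅ with ind U U⊆T U≠∅
... | j , C∋j , nonzero = j , C⊆C′ j C∋j , nonzero

independent-⊆ : ∀ {n} (G : Graph n) C T T′ → T′ ⊆ T → Independent G C T → Independent G C T′
independent-⊆ G C T T′ T′⊆T ind U U⊆T′ = ind U (λ i h → T′⊆T i (U⊆T′ i h))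

independent-zeroRow : ∀ {n} (G : Graph (suc n)) C T b → (∀ j → C ∋ j → adj G b j ≡ false) →
  Independent G C T → lookup T b ≡ false
independent-zeroRow G C T b row-b ind = ¬-not λ T∋b →
  let j , C∋j , nonzero = ind (∅ [ b ]≔ true) ([]≔true-⊆ {U = ∅} {T = T} b (∅⊆ T) T∋b)
                              (b , lookup∘update b ∅ true)
  in true≢false nonzero (trans (rowComb-add G ∅ b j (lookup-replicate b false))
                          (trans (cong (_xor rowComb G ∅ j) (row-b j C∋j))
                                 (rowComb-zero G ∅ j λ i h → true≢false h (lookup-replicate i false))))

independent-dropZeroColumn : ∀ {n} (G : Graph (suc n)) C T c → (∀ i → T ∋ i → adj G i c ≡ false) →
  Independent G C T → Independent G (C [ c ]≔ false) T
independent-dropZeroColumn G C T c column-c ind U U⊆T U≠∅ with ind U U⊆T U≠∅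
... | j , C∋j , nonzero = j , ∋-[]≔false {U = C} C∋j j≢c , nonzero
  where
  j≢c : j ≢ c
  j≢c refl = true≢false nonzero (rowComb-zero G U c λ i h → column-c i (U⊆T i h))

-- The nonempty U ⊆ T whose combination vanishes on C − c is unique when it exists (two of them
-- would add up to a combination vanishing on C); removing one of its rows u₀ restores independence.
independent-dropColumn : ∀ {n} (G : Graph (suc n)) C T c → Independent G C T →
  ∃ λ T′ → T′ ⊆ T × ∣ T ∣ ≤ suc ∣ T′ ∣ × Independent G (C [ c ]≔ false) T′
independent-dropColumn G C T c ind with independent-or-dependent G (C [ c ]≔ false) T
... | inj₁ ind′ = T , (λ i h → h) , ℕ.n≤1+n _ , ind′
... | inj₂ (U₀ , U₀⊆T , (u₀ , U₀∋u₀) , U₀-vanishes) =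
  T [ u₀ ]≔ false , []≔false-⊆ T u₀ , ∣∣≤suc∣[]≔false∣ T u₀ , ind′
  where
  U₀-at-c : rowComb G U₀ c ≡ true
  U₀-at-c with ind U₀ U₀⊆T (u₀ , U₀∋u₀)
  ... | j , C∋j , nonzero with j ≟ c
  ... | yes refl = nonzero
  ... | no j≢c = true≢false nonzero (U₀-vanishes j (∋-[]≔false {U = C} C∋j j≢c))

  -- V ⊕ U₀ is nonempty (it contains u₀) and vanishes at c, so its witness lies off c, where U₀ vanishes.
  avoid-c : ∀ V → V ⊆ (T [ u₀ ]≔ false) → rowComb G V c ≡ true →
            ∃ λ j → (C [ c ]≔ false) ∋ j × rowComb G V j ≡ true
  avoid-c V V⊆T′ V-at-c
    with ind (zipWith _xor_ V U₀) (xor-⊆ {U = V} {U₀} {T} (λ i h → []≔false-⊆ T u₀ i (V⊆T′ i h)) U₀⊆T)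
             (u₀ , W∋u₀)
    where
    W∋u₀ : zipWith _xor_ V U₀ ∋ u₀
    W∋u₀ = trans (lookup-zipWith _xor_ u₀ V U₀)
             (cong₂ _xor_ (⊆-∉ V (T [ u₀ ]≔ false) V⊆T′ (lookup∘update u₀ T false)) U₀∋u₀)
  ... | j , C∋j , nonzero with j ≟ c
  ... | yes refl = true≢false nonzero (trans (rowComb-xor G V U₀ c) (cong₂ _xor_ V-at-c U₀-at-c))
  ... | no j≢c = j , C′∋j , trans (sym (xor-identityʳ _))
                              (trans (cong (rowComb G V j xor_) (sym (U₀-vanishes j C′∋j)))
                                     (trans (sym (rowComb-xor G V U₀ j)) nonzero))
    where
    C′∋j : (C [ c ]≔ false) ∋ j
    C′∋j = ∋-[]≔false {U = C} C∋j j≢c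

  ind′ : Independent G (C [ c ]≔ false) (T [ u₀ ]≔ false)
  ind′ V V⊆T′ V≠∅ with ind V (λ i h → []≔false-⊆ T u₀ i (V⊆T′ i h)) V≠∅
  ... | j , C∋j , nonzero with j ≟ c
  ... | yes refl = avoid-c V V⊆T′ nonzero
  ... | no j≢c = j , ∋-[]≔false {U = C} C∋j j≢c , nonzero

-- Rank after deleting a vertex, an isolated vertex, or both ends of a pendant edge

punchIn-or-self : ∀ {n} (b i : Fin (suc n)) → i ≡ b ⊎ ∃ λ j → punchIn b j ≡ i
punchIn-or-self b i with i ≟ b
... | yes i≡b = inj₁ i≡b
... | no i≢b = inj₂ (punchOut (i≢b ∘ sym) , punchIn-punchOut (i≢b ∘ sym))

insertAt-surjective : ∀ {n} (U : Subset (suc n)) b → lookup U b ≡ false → ∃ λ U′ → insertAt U′ b false ≡ U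
insertAt-surjective U b b∉U = removeAt U b , trans (cong (insertAt (removeAt U b) b) (sym b∉U)) (insertAt-removeAt U b)

module _ {n} (b : Fin (suc n)) where
  insertAt-⊆ : ∀ {T S : Subset n} → T ⊆ S → insertAt T b false ⊆ insertAt S b false
  insertAt-⊆ {T} {S} T⊆S i h with punchIn-or-self b i
  ... | inj₁ refl = true≢false h (insertAt-lookup T b false)
  ... | inj₂ (j , refl) = trans (insertAt-punchIn S b false j) (T⊆S j (trans (sym (insertAt-punchIn T b false j)) h))

  insertAt-⊆⁻ : ∀ {T S : Subset n} → insertAt T b false ⊆ insertAt S b false → T ⊆ S
  insertAt-⊆⁻ {T} {S} T⊆S j h =
    trans (sym (insertAt-punchIn S b false j)) (T⊆S (punchIn b j) (trans (insertAt-punchIn T b false j) h))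

  insertAt-nonempty⁻ : ∀ {U : Subset n} → Nonempty (insertAt U b false) → Nonempty U
  insertAt-nonempty⁻ {U} (i , h) with punchIn-or-self b i
  ... | inj₁ refl = true≢false h (insertAt-lookup U b false)
  ... | inj₂ (j , refl) = j , trans (sym (insertAt-punchIn U b false j)) h

module _ {n} (G : Graph (suc n)) (b : Fin (suc n)) (S T : Subset n) where
  independent-insertAt : Independent (deleteVertex G b) S T → Independent G (insertAt S b false) (insertAt T b false)
  independent-insertAt ind U U⊆T U≠∅
    with insertAt-surjective U b (⊆-∉ U (insertAt T b false) U⊆T (insertAt-lookup T b false))
  ... | U′ , refl with ind U′ (insertAt-⊆⁻ b U⊆T) (insertAt-nonempty⁻ b U≠∅)
  ... | j , S∋j , nonzero =
    punchIn b j , trans (insertAt-punchIn S b false j) S∋j , trans (rowComb-deleteVertex G U′ b j) nonzero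

  independent-insertAt⁻ : Independent G (insertAt S b false) (insertAt T b false) → Independent (deleteVertex G b) S T
  independent-insertAt⁻ ind U U⊆T (i , U∋i)
    with ind (insertAt U b false) (insertAt-⊆ b U⊆T) (punchIn b i , trans (insertAt-punchIn U b false i) U∋i)
  ... | j , S∋j , nonzero with punchIn-or-self b j
  ... | inj₁ refl = true≢false S∋j (insertAt-lookup S b false)
  ... | inj₂ (j′ , refl) =
    j′ , trans (sym (insertAt-punchIn S b false j′)) S∋j , trans (sym (rowComb-deleteVertex G U b j′)) nonzero

rank-deleteVertex : ∀ {n} (G : Graph (suc n)) b S → rank G (insertAt S b false) ≡ rank (deleteVertex G b) S
rank-deleteVertex G b S = ℕ.≤-antisym (rank-≤ G (insertAt S b false) bound) (rank-≤ (deleteVertex G b) S lift)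
  where
  bound : ∀ T → T ⊆ insertAt S b false → Independent G (insertAt S b false) T →
          ∣ T ∣ ≤ rank (deleteVertex G b) S
  bound T T⊆S ind with insertAt-surjective T b (⊆-∉ T (insertAt S b false) T⊆S (insertAt-lookup S b false))
  ... | T′ , refl = subst (_≤ rank (deleteVertex G b) S) (sym (∣insertAt∣ T′ b false))
                      (rank-≥ (deleteVertex G b) S T′ (insertAt-⊆⁻ b T⊆S) (independent-insertAt⁻ G b S T′ ind))
  lift : ∀ T → T ⊆ S → Independent (deleteVertex G b) S T → ∣ T ∣ ≤ rank G (insertAt S b false)
  lift T T⊆S ind = subst (_≤ rank G (insertAt S b false)) (∣insertAt∣ T b false)
                     (rank-≥ G (insertAt S b false) (insertAt T b false) (insertAt-⊆ b T⊆S)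
                             (independent-insertAt G b S T ind))

rank-isolated : ∀ {n} (G : Graph (suc n)) S b → (∀ j → S ∋ j → adj G b j ≡ false) →
                rank G S ≡ rank G (S [ b ]≔ false)
rank-isolated G S b row-b = ℕ.≤-antisym (rank-≤ G S bound) (rank-≤ G (S [ b ]≔ false) lift)
  where
  bound : ∀ T → T ⊆ S → Independent G S T → ∣ T ∣ ≤ rank G (S [ b ]≔ false)
  bound T T⊆S ind = rank-≥ G (S [ b ]≔ false) T (⊆-[]≔false {T = T} {S} b b∉T T⊆S)
    (independent-dropZeroColumn G S T b (λ i T∋i → trans (adj-sym G i b) (row-b i (T⊆S i T∋i))) ind)
    where
    b∉T : lookup T b ≡ false
    b∉T = independent-zeroRow G S T b row-b ind
  lift : ∀ T → T ⊆ (S [ b ]≔ false) → Independent G (S [ b ]≔ false) T → ∣ T ∣ ≤ rank G S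
  lift T T⊆S′ ind = rank-≥ G S T (λ i h → []≔false-⊆ S b i (T⊆S′ i h))
                           (independent-widen G (S [ b ]≔ false) S T ([]≔false-⊆ S b) ind)

module Pendant {n} (G : Graph (suc n)) {a b : Fin (suc n)} (a≢b : a ≢ b)
               (edge : adj G b a ≡ true) (only-a : ∀ j → j ≢ a → adj G b j ≡ false) where

  column-b : ∀ U → rowComb G U b ≡ lookup U a
  column-b U = trans (rowComb-column G U a b λ i i≢a → trans (adj-sym G i b) (only-a i i≢a))
                     (trans (cong (lookup U a ∧_) (trans (adj-sym G a b) edge)) (∧-identityʳ _))

  withoutEnds : Subset (suc n) → Subset (suc n)
  withoutEnds S = (S [ b ]≔ false) [ a ]≔ false

  withoutEnds-⊆ : ∀ S → withoutEnds S ⊆ S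
  withoutEnds-⊆ S i h = []≔false-⊆ S b i ([]≔false-⊆ (S [ b ]≔ false) a i h)

  ∋-withoutEnds : ∀ {S j} → S ∋ j → j ≢ a → j ≢ b → withoutEnds S ∋ j
  ∋-withoutEnds {S} S∋j j≢a j≢b = ∋-[]≔false {U = S [ b ]≔ false} (∋-[]≔false {U = S} S∋j j≢b) j≢a

  a∉withoutEnds : ∀ S → lookup (withoutEnds S) a ≡ false
  a∉withoutEnds S = lookup∘update a (S [ b ]≔ false) false

  b∉withoutEnds : ∀ S → lookup (withoutEnds S) b ≡ false
  b∉withoutEnds S = trans (lookup∘update′ (a≢b ∘ sym) (S [ b ]≔ false) false) (lookup∘update b S false)

  independent-addEnds : ∀ S T → S ∋ a → S ∋ b → Independent G (withoutEnds S) T →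
                        Independent G S ((T [ a ]≔ true) [ b ]≔ true)
  independent-addEnds S T S∋a S∋b ind U U⊆T⁺ (i , U∋i) with lookup U a in U∋a
  ... | true = b , S∋b , trans (column-b U) U∋a
  ... | false with nonempty-or-empty (U [ b ]≔ false)
  ... | inj₁ U⁻≠∅ with ind (U [ b ]≔ false) U⁻⊆T U⁻≠∅
    where
    U⁻⊆T : (U [ b ]≔ false) ⊆ T
    U⁻⊆T j h with j ≟ b | j ≟ a
    ... | yes refl | _ = true≢false h (lookup∘update b U false)
    ... | no _ | yes refl = true≢false ([]≔false-⊆ U b a h) U∋a
    ... | no j≢b | no j≢a =
      trans (sym (trans (lookup∘update′ j≢b (T [ a ]≔ true) true) (lookup∘update′ j≢a T true)))
            (U⊆T⁺ j ([]≔false-⊆ U b j h))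
  ... | j , S′∋j , nonzero = j , withoutEnds-⊆ S j S′∋j ,
    trans (rowComb-split G U b j)
          (trans (cong₂ (λ c d → (lookup U b ∧ c) xor d) (only-a j j≢a) nonzero)
                 (cong (_xor true) (∧-zeroʳ (lookup U b))))
    where
    j≢a : j ≢ a
    j≢a refl = true≢false S′∋j (a∉withoutEnds S)
  independent-addEnds S T S∋a S∋b ind U U⊆T⁺ (i , U∋i) | false | inj₂ U⁻≡∅ =
    a , S∋a , trans (rowComb-split G U b a)
                (trans (cong₂ (λ c d → (c ∧ adj G b a) xor d) U∋b U⁻-at-a)
                       (cong (λ c → (true ∧ c) xor false) edge))
    where
    U∋b : U ∋ b
    U∋b with i ≟ b
    ... | yes refl = U∋i
    ... | no i≢b = true≢false (trans (lookup∘update′ i≢b U false) U∋i) (U⁻≡∅ i)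
    U⁻-at-a : rowComb G (U [ b ]≔ false) a ≡ false
    U⁻-at-a = rowComb-zero G (U [ b ]≔ false) a λ j h → true≢false h (U⁻≡∅ j)

  -- Row b is the unit vector at a, so it can cancel a combination's entry in column a.
  witness-avoidingEnds : ∀ S T U → T ∋ b → Independent G S T → U ⊆ T → Nonempty U →
    lookup U a ≡ false → lookup U b ≡ false → ∃ λ j → S ∋ j × j ≢ a × j ≢ b × rowComb G U j ≡ true
  witness-avoidingEnds S T U T∋b ind U⊆T U≠∅ a∉U b∉U with rowComb G U a in U-at-a
  ... | false with ind U U⊆T U≠∅
  ... | j , S∋j , nonzero = j , S∋j , j≢a , j≢b , nonzero
    where
    j≢a : j ≢ a
    j≢a refl = true≢false nonzero U-at-a
    j≢b : j ≢ b
    j≢b refl = true≢false (trans (sym (column-b U)) nonzero) a∉U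
  witness-avoidingEnds S T U T∋b ind U⊆T U≠∅ a∉U b∉U | true
    with ind (U [ b ]≔ true) ([]≔true-⊆ {U = U} {T = T} b U⊆T T∋b) (b , lookup∘update b U true)
  ... | j , S∋j , nonzero = j , S∋j , j≢a , j≢b , trans (sym (cong (_xor rowComb G U j) (only-a j j≢a))) U⁺-at-j
    where
    U⁺-at-j : adj G b j xor rowComb G U j ≡ true
    U⁺-at-j = trans (sym (rowComb-add G U b j b∉U)) nonzero
    j≢a : j ≢ a
    j≢a refl = true≢false U⁺-at-j (cong₂ _xor_ edge U-at-a)
    j≢b : j ≢ b
    j≢b refl = true≢false (trans (sym (column-b (U [ b ]≔ true))) nonzero)
                          (trans (lookup∘update′ a≢b U true) a∉U)

  independent-removeEnds : ∀ S T → T ∋ b → Independent G S T → Independent G (withoutEnds S) (withoutEnds T)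
  independent-removeEnds S T T∋b ind U U⊆T₀ U≠∅ =
    let j , S∋j , j≢a , j≢b , nonzero =
          witness-avoidingEnds S T U T∋b ind (λ i h → withoutEnds-⊆ T i (U⊆T₀ i h)) U≠∅
            (⊆-∉ U (withoutEnds T) U⊆T₀ (a∉withoutEnds T)) (⊆-∉ U (withoutEnds T) U⊆T₀ (b∉withoutEnds T))
    in j , ∋-withoutEnds {S} S∋j j≢a j≢b , nonzero

  rank-pendant : ∀ S → S ∋ a → S ∋ b → rank G S ≡ 2 + rank G (withoutEnds S)
  rank-pendant S S∋a S∋b = ℕ.≤-antisym (rank-≤ G S bound) (rank-liftIndependent G S (withoutEnds S) 2 lift)
    where
    lift : ∀ T → T ⊆ withoutEnds S → Independent G (withoutEnds S) T → 2 + ∣ T ∣ ≤ rank G S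
    lift T T⊆S′ ind = subst (_≤ rank G S) card (rank-≥ G S T⁺ T⁺⊆S (independent-addEnds S T S∋a S∋b ind))
      where
      T⁺ : Subset (suc n)
      T⁺ = (T [ a ]≔ true) [ b ]≔ true
      T⊆S : T ⊆ S
      T⊆S i h = withoutEnds-⊆ S i (T⊆S′ i h)
      T⁺⊆S : T⁺ ⊆ S
      T⁺⊆S = []≔true-⊆ {U = T [ a ]≔ true} {T = S} b ([]≔true-⊆ {U = T} {T = S} a T⊆S S∋a) S∋b
      card : ∣ T⁺ ∣ ≡ 2 + ∣ T ∣
      card = trans (∣[]≔true∣ (T [ a ]≔ true) b (trans (lookup∘update′ (a≢b ∘ sym) T true) b∉T))
                   (cong suc (∣[]≔true∣ T a a∉T))
        where
        a∉T : lookup T a ≡ false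
        a∉T = ⊆-∉ T (withoutEnds S) T⊆S′ (a∉withoutEnds S)
        b∉T : lookup T b ≡ false
        b∉T = ⊆-∉ T (withoutEnds S) T⊆S′ (b∉withoutEnds S)

    bound-with-b : ∀ T → T ⊆ S → Independent G S T → T ∋ b → ∣ T ∣ ≤ 2 + rank G (withoutEnds S)
    bound-with-b T T⊆S ind T∋b =
      ℕ.≤-trans (ℕ.≤-trans (∣∣≤suc∣[]≔false∣ T b) (s≤s (∣∣≤suc∣[]≔false∣ (T [ b ]≔ false) a)))
                (s≤s (s≤s (rank-≥ G (withoutEnds S) (withoutEnds T) T₀⊆S′ (independent-removeEnds S T T∋b ind))))
      where
      T₀⊆S′ : withoutEnds T ⊆ withoutEnds S
      T₀⊆S′ = []≔false-mono {T = T [ b ]≔ false} {S [ b ]≔ false} a ([]≔false-mono {T = T} {S} b T⊆S)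

    -- Drop row a; then column b vanishes on the remaining rows, and dropping column a costs one row.
    bound-without-b : ∀ T → T ⊆ S → Independent G S T → lookup T b ≡ false →
                      ∣ T ∣ ≤ 2 + rank G (withoutEnds S)
    bound-without-b T T⊆S ind b∉T
      with independent-dropColumn G (S [ b ]≔ false) (T [ a ]≔ false) a
             (independent-dropZeroColumn G S (T [ a ]≔ false) b column-b-zero
               (independent-⊆ G S T (T [ a ]≔ false) ([]≔false-⊆ T a) ind))
      where
      column-b-zero : ∀ i → (T [ a ]≔ false) ∋ i → adj G i b ≡ false
      column-b-zero i h = trans (adj-sym G i b) (only-a i λ { refl → true≢false h (lookup∘update a T false) })
    ... | T″ , T″⊆T′ , ∣T′∣≤ , ind″ =
      ℕ.≤-trans (∣∣≤suc∣[]≔false∣ T a)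
                (s≤s (ℕ.≤-trans ∣T′∣≤ (s≤s (rank-≥ G (withoutEnds S) T″ T″⊆S′ ind″))))
      where
      T″⊆T : T″ ⊆ T
      T″⊆T i h = []≔false-⊆ T a i (T″⊆T′ i h)
      T″⊆S′ : T″ ⊆ withoutEnds S
      T″⊆S′ = ⊆-[]≔false {T = T″} {S [ b ]≔ false} a
                (⊆-∉ T″ (T [ a ]≔ false) T″⊆T′ (lookup∘update a T false))
                (⊆-[]≔false {T = T″} {S} b (⊆-∉ T″ T T″⊆T b∉T) (λ i h → T⊆S i (T″⊆T i h)))

    bound : ∀ T → T ⊆ S → Independent G S T → ∣ T ∣ ≤ 2 + rank G (withoutEnds S)
    bound T T⊆S ind with lookup T b in T∋b
    ... | true = bound-with-b T T⊆S ind T∋b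
    ... | false = bound-without-b T T⊆S ind T∋b

-- The weighted interlace polynomial

module PendantReduction {c ℓ} (R : CommutativeRing c ℓ) where
  open CommutativeRing R
    renaming (_+_ to _+ᴿ_; refl to ≈-refl; sym to ≈-sym; trans to ≈-trans; reflexive to ≈-reflexive)
  open WeightedInterlace R
  open import Relation.Binary.Reasoning.Setoid setoid
  open import Algebra.Solver.Ring.NaturalCoefficients.Default commutativeSemiring
  module Σ = SubsetSum +-commutativeMonoid
  module Π = MonoidSum *-commutativeMonoid

  weight : ∀ {n} → (α β : Fin n → Carrier) → Subset n → Fin n → Carrier
  weight α β S v = if lookup S v then α v else β v

  prod-weight : ∀ {n} (α β : Fin n → Carrier) S →
                prodᴿ (map (weight α β S) (allFin n)) ≡ Π.sum (weight α β S)
  prod-weight α β S = SubsetSum.sum-allFin *-commutativeMonoid (weight α β S)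

  prod-weight-insertAt : ∀ {k} (α β : Fin (suc k) → Carrier) (s : Subset k) p u →
    Π.sum (weight α β (insertAt s p u))
      ≈ (if u then α p else β p) * Π.sum (weight (α ∘ punchIn p) (β ∘ punchIn p) s)
  prod-weight-insertAt α β s p u = ≈-trans (Π.sum-remove {i = p} (weight α β (insertAt s p u)))
    (*-cong (≈-reflexive (cong (λ z → if z then α p else β p) (insertAt-lookup s p u)))
            (Π.sum-cong-≋ λ i → ≈-reflexive (cong (λ z → if z then α (punchIn p i) else β (punchIn p i))
                                                   (insertAt-punchIn s p u i))))

  summand : ∀ {n} (x y : Carrier) (α β : Fin n → Carrier) → Graph n → Subset n → Carrier
  summand {n} x y α β G S =
    prodᴿ (map (λ v → if lookup S v then α v else β v) (allFin n))
      * ((x - 1#) ^ᴿ rank G S) * ((y - 1#) ^ᴿ nullity G S)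

  summand-cong : ∀ (X Y : Carrier) {p p′} r {r′} ν {ν′} → p ≈ p′ → r ≡ r′ → ν ≡ ν′ →
    p * X ^ᴿ r * Y ^ᴿ ν ≈ p′ * X ^ᴿ r′ * Y ^ᴿ ν′
  summand-cong X Y r ν p≈p′ refl refl = *-congʳ (*-congʳ p≈p′)

  -- The four summands of q(G) whose subsets agree off {a, b}, ordered (a ∉, b ∉), (a ∉, b ∈),
  -- (a ∈, b ∉), (a ∈, b ∈), against the two summands of q(G′).
  four-summands : ∀ αa αb βa βb P Xr Yν Xr₁ Yν₁ X Y →
    (βb * (βa * P)) * Xr * Yν +ᴿ (αb * (βa * P)) * Xr * (Y * Yν)
      +ᴿ ((βb * (αa * P)) * Xr₁ * Yν₁ +ᴿ (αb * (αa * P)) * (X * (X * Xr)) * Yν)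
    ≈ ((αa * αb * (X * (X * 1#)) +ᴿ βa * αb * Y +ᴿ βa * βb) * P) * Xr * Yν
      +ᴿ ((αa * βb) * P) * Xr₁ * Yν₁
  four-summands = solve 11 (λ αa αb βa βb P Xr Yν Xr₁ Yν₁ X Y →
    (βb :* (βa :* P)) :* Xr :* Yν :+ (αb :* (βa :* P)) :* Xr :* (Y :* Yν)
      :+ ((βb :* (αa :* P)) :* Xr₁ :* Yν₁ :+ (αb :* (αa :* P)) :* (X :* (X :* Xr)) :* Yν)
    := ((αa :* αb :* (X :* (X :* con 1)) :+ βa :* αb :* Y :+ βa :* βb) :* P) :* Xr :* Yν
       :+ ((αa :* βb) :* P) :* Xr₁ :* Yν₁) ≈-refl

  module _ (x y : Carrier) {k} (G : Graph (suc (suc k))) (α β : Fin (suc (suc k)) → Carrier)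
           {a b : Fin (suc (suc k))} (a≢b : a ≢ b)
           (edge : adj G b a ≡ true) (only-a : ∀ v → v ≢ a → adj G b v ≡ false) where
    private
      X Y : Carrier
      X = x - 1#
      Y = y - 1#
      G′ : Graph (suc k)
      G′ = deleteVertex G b
      a′ : Fin (suc k)
      a′ = punchOut (a≢b ∘ sym)
      α′ β′ : Fin (suc k) → Carrier
      α′ = α-new α β a b
      β′ = β-new x y α β a b
      open Pendant G a≢b edge only-a

    punchIn-a′ : punchIn b a′ ≡ a
    punchIn-a′ = punchIn-punchOut (a≢b ∘ sym)

    α′-a′ : α′ a′ ≡ α a * β b
    α′-a′ with punchIn b a′ ≟ a
    ... | yes _ = refl
    ... | no ≢a = contradiction punchIn-a′ ≢a

    β′-a′ : β′ a′ ≡ α a * α b * X ^ᴿ 2 +ᴿ β a * α b * Y +ᴿ β a * β b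
    β′-a′ with punchIn b a′ ≟ a
    ... | yes _ = refl
    ... | no ≢a = contradiction punchIn-a′ ≢a

    α′-other : ∀ i → α′ (punchIn a′ i) ≡ α (punchIn b (punchIn a′ i))
    α′-other i with punchIn b (punchIn a′ i) ≟ a
    ... | yes ≡a = contradiction (punchIn-injective b _ _ (trans ≡a (sym punchIn-a′))) (punchInᵢ≢i a′ i)
    ... | no _ = refl

    β′-other : ∀ i → β′ (punchIn a′ i) ≡ β (punchIn b (punchIn a′ i))
    β′-other i with punchIn b (punchIn a′ i) ≟ a
    ... | yes ≡a = contradiction (punchIn-injective b _ _ (trans ≡a (sym punchIn-a′))) (punchInᵢ≢i a′ i)
    ... | no _ = refl

    withA : Subset k → Bool → Subset (suc k)
    withA s u = insertAt s a′ u

    withAB : Subset k → Bool → Bool → Subset (suc (suc k))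
    withAB s u v = insertAt (withA s u) b v

    withAB-a : ∀ (s : Subset k) u v → lookup (withAB s u v) a ≡ u
    withAB-a s u v = trans (cong (lookup (withAB s u v)) (sym punchIn-a′))
                           (trans (insertAt-punchIn (withA s u) b v a′) (insertAt-lookup s a′ u))

    rank-b∉ : ∀ (t : Subset (suc k)) → rank G (insertAt t b false) ≡ rank G′ t
    rank-b∉ = rank-deleteVertex G b

    nullity-b∉ : ∀ (t : Subset (suc k)) → nullity G (insertAt t b false) ≡ nullity G′ t
    nullity-b∉ t = cong₂ _∸_ (∣insertAt∣ t b false) (rank-b∉ t)

    rank-b∈a∉ : ∀ (s : Subset k) → rank G (withAB s false true) ≡ rank G′ (withA s false)
    rank-b∈a∉ s = trans (rank-isolated G S b row-b-zero)
                        (trans (cong (rank G) (insertAt-[]≔ (withA s false) b true false)) (rank-b∉ _))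
      where
      S : Subset (suc (suc k))
      S = withAB s false true
      row-b-zero : ∀ j → S ∋ j → adj G b j ≡ false
      row-b-zero j S∋j = only-a j λ { refl → true≢false S∋j (withAB-a s false true) }

    nullity-b∈a∉ : ∀ (s : Subset k) → nullity G (withAB s false true) ≡ suc (nullity G′ (withA s false))
    nullity-b∈a∉ s = trans (cong₂ _∸_ (∣insertAt∣ (withA s false) b true) (rank-b∈a∉ s))
                           (ℕ.+-∸-assoc 1 (rank≤∣∣ G′ (withA s false)))

    rank-b∈a∈ : ∀ (s : Subset k) → rank G (withAB s true true) ≡ 2 + rank G′ (withA s false)
    rank-b∈a∈ s = trans (rank-pendant S (withAB-a s true true) (insertAt-lookup (withA s true) b true))
                        (cong (2 +_) (trans (cong (rank G) ends) (rank-b∉ _)))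
      where
      S : Subset (suc (suc k))
      S = withAB s true true
      ends : withoutEnds S ≡ withAB s false false
      ends = trans (cong₂ (λ U i → U [ i ]≔ false) (insertAt-[]≔ (withA s true) b true false) (sym punchIn-a′))
               (trans (insertAt-[]≔-punchIn (withA s true) b false a′ false)
                      (cong (λ t → insertAt t b false) (insertAt-[]≔ s a′ true false)))

    nullity-b∈a∈ : ∀ (s : Subset k) → nullity G (withAB s true true) ≡ nullity G′ (withA s false)
    nullity-b∈a∈ s =
      trans (cong₂ _∸_ (trans (∣insertAt∣ (withA s true) b true) (cong suc (∣insertAt∣ s a′ true))) (rank-b∈a∈ s))
            (cong (_∸ rank G′ (withA s false)) (sym (∣insertAt∣ s a′ false)))

    P : Subset k → Carrier
    P s = Π.sum (weight (α ∘ punchIn b ∘ punchIn a′) (β ∘ punchIn b ∘ punchIn a′) s)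

    weight-G : ∀ (s : Subset k) u v → prodᴿ (map (weight α β (withAB s u v)) (allFin (suc (suc k))))
                                      ≈ (if v then α b else β b) * ((if u then α a else β a) * P s)
    weight-G s u v = ≈-trans (≈-reflexive (prod-weight α β (withAB s u v)))
      (≈-trans (prod-weight-insertAt α β (withA s u) b v)
      (*-congˡ (≈-trans (prod-weight-insertAt (α ∘ punchIn b) (β ∘ punchIn b) s a′ u)
                        (*-congʳ (≈-reflexive (cong (λ z → if u then α z else β z) punchIn-a′))))))

    weight-G′ : ∀ (s : Subset k) u → prodᴿ (map (weight α′ β′ (withA s u)) (allFin (suc k)))
                                    ≈ (if u then α′ a′ else β′ a′) * P s
    weight-G′ s u = ≈-trans (≈-reflexive (prod-weight α′ β′ (withA s u)))
      (≈-trans (prod-weight-insertAt α′ β′ s a′ u)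
        (*-congˡ (Π.sum-cong-≋ λ i →
          ≈-reflexive (cong₂ (λ p q → if lookup s i then p else q) (α′-other i) (β′-other i)))))

    F : Subset (suc (suc k)) → Carrier
    F = summand x y α β G
    H : Subset (suc k) → Carrier
    H = summand x y α′ β′ G′

    summands-agree : ∀ (s : Subset k) →
      (F (withAB s false false) +ᴿ F (withAB s false true))
        +ᴿ (F (withAB s true false) +ᴿ F (withAB s true true))
      ≈ H (withA s false) +ᴿ H (withA s true)
    summands-agree s = begin
      (F (withAB s false false) +ᴿ F (withAB s false true)) +ᴿ (F (withAB s true false) +ᴿ F (withAB s true true))
        ≈⟨ +-cong (+-cong
             (summand-cong X Y _ _ (weight-G s false false) (rank-b∉ s₀) (nullity-b∉ s₀))
             (summand-cong X Y _ _ (weight-G s false true) (rank-b∈a∉ s) (nullity-b∈a∉ s)))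
           (+-cong
             (summand-cong X Y _ _ (weight-G s true false) (rank-b∉ s₁) (nullity-b∉ s₁))
             (summand-cong X Y _ _ (weight-G s true true) (rank-b∈a∈ s) (nullity-b∈a∈ s))) ⟩
      (β b * (β a * P s)) * X ^ᴿ r * Y ^ᴿ ν +ᴿ (α b * (β a * P s)) * X ^ᴿ r * (Y * Y ^ᴿ ν)
        +ᴿ ((β b * (α a * P s)) * X ^ᴿ r₁ * Y ^ᴿ ν₁ +ᴿ (α b * (α a * P s)) * (X * (X * X ^ᴿ r)) * Y ^ᴿ ν)
        ≈⟨ four-summands (α a) (α b) (β a) (β b) (P s) (X ^ᴿ r) (Y ^ᴿ ν) (X ^ᴿ r₁) (Y ^ᴿ ν₁) X Y ⟩
      ((α a * α b * X ^ᴿ 2 +ᴿ β a * α b * Y +ᴿ β a * β b) * P s) * X ^ᴿ r * Y ^ᴿ ν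
        +ᴿ ((α a * β b) * P s) * X ^ᴿ r₁ * Y ^ᴿ ν₁
        ≈⟨ ≈-sym (+-cong
             (summand-cong X Y r ν (≈-trans (weight-G′ s false) (*-congʳ (≈-reflexive β′-a′))) refl refl)
             (summand-cong X Y r₁ ν₁ (≈-trans (weight-G′ s true) (*-congʳ (≈-reflexive α′-a′))) refl refl)) ⟩
      H s₀ +ᴿ H s₁ ∎
      where
      s₀ s₁ : Subset (suc k)
      s₀ = withA s false
      s₁ = withA s true
      r ν r₁ ν₁ : ℕ
      r = rank G′ s₀
      ν = nullity G′ s₀
      r₁ = rank G′ s₁
      ν₁ = nullity G′ s₁

    pendant-reduction : q x y α β G ≈ q x y α′ β′ G′
    pendant-reduction = begin
      Σ.sumSubsets (suc (suc k)) F
        ≈⟨ Σ.sumSubsets-insertAt (suc k) b F ⟩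
      Σ.sumSubsets (suc k) (λ t → F (insertAt t b false) +ᴿ F (insertAt t b true))
        ≈⟨ Σ.sumSubsets-insertAt k a′ _ ⟩
      Σ.sumSubsets k (λ s → (F (withAB s false false) +ᴿ F (withAB s false true))
                         +ᴿ (F (withAB s true false) +ᴿ F (withAB s true true)))
        ≈⟨ Σ.sumList-map-cong (subsets k) summands-agree ⟩
      Σ.sumSubsets k (λ s → H (withA s false) +ᴿ H (withA s true))
        ≈⟨ ≈-sym (Σ.sumSubsets-insertAt k a′ H) ⟩
      Σ.sumSubsets (suc k) H ∎

-- The hypothesis adj G b b ≡ false is the instance v = b of the last one, hence unused.
theorem4 : ∀ {c ℓ} (R : CommutativeRing c ℓ) →
    let open CommutativeRing R
        open WeightedInterlace R
    in (x y : Carrier) (m : ℕ) (G : Graph (suc m)) (α β : Fin (suc m) → Carrier)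
       (a b : Fin (suc m)) → a ≢ b →
       adj G b b ≡ false →
       adj G b a ≡ true →
       (∀ v → v ≢ a → adj G b v ≡ false) →
       q x y α β G ≈ q x y (α-new α β a b) (β-new x y α β a b) (deleteVertex G b)
theorem4 R x y zero G α β zero zero a≢b _ _ _ = contradiction refl a≢b
theorem4 R x y (suc k) G α β a b a≢b _ edge only-a = PendantReduction.pendant-reduction R x y G α β a≢b edge only-a
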